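{- Let $G$ be a finite group containing a regular $(v,k,\lambda,\mu)$-partial difference set $D$. If $h\in G$ satisfies $h\neq h^{ -1}$ and $h^{ -1}\in h^G$, then $|h^G\cap D|$ is even.
   Context: A subset $D$ of a finite group $G$ of order $v$ with $|D|=k$ is a $(v,k,\lambda,\mu)$-partial difference set if every nonidentity element of $D$ can be written as $xy^{ -1}$ with $x,y\in D$ in exactly $\lambda$ ways, and every nonidentity element of $G\setminus D$ in exactly $\mu$ ways; it is regular if $D=\{d^{ -1}:d\in D\}$ and $1\notin D$. $h^G$ is the conjugacy class of $h$. -}

module Defs where

open import Data.Nat using (ℕ)
open import Data.Fin using (Fin)
open import Data.Fin.Properties using (_≟_; any?)
open import Data.Fin.Subset using (Subset; _∈_; _∉_; ∣_∣)
open import Data.Fin.Subset.Properties using (_∈?_)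
open import Data.List using (List; length; filter; allFin; cartesianProduct)
open import Data.Product using (Σ; _×_; _,_)
open import Relation.Nullary using (¬_)
open import Relation.Nullary.Decidable using (_×-dec_)
open import Relation.Binary.PropositionalEquality using (_≡_)
open import Algebra.Structures using (IsGroup)

record FiniteGroup : Set where
  infixl 7 _∙_
  field
    order   : ℕ
    _∙_     : Fin order → Fin order → Fin order
    ε       : Fin order
    _⁻¹     : Fin order → Fin order
    isGroup : IsGroup _≡_ _∙_ ε _⁻¹

module _ (G : FiniteGroup) where
  open FiniteGroup G

  repCount : Subset order → Fin order → ℕ
  repCount D g =
    length (filter (λ p → (Data.Product.proj₁ p ∈? D) ×-dec
                          ((Data.Product.proj₂ p ∈? D) ×-dec
                           ((Data.Product.proj₁ p ∙ (Data.Product.proj₂ p ⁻¹)) ≟ g)))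
                   (cartesianProduct (allFin order) (allFin order)))

  record IsPDS (D : Subset order) (v k lam mu : ℕ) : Set where
    field
      order≡v  : order ≡ v
      size≡k   : ∣ D ∣ ≡ k
      inD      : ∀ g → g ∈ D → ¬ (g ≡ ε) → repCount D g ≡ lam
      notInD   : ∀ g → g ∉ D → ¬ (g ≡ ε) → repCount D g ≡ mu

  record IsRegularPDS (D : Subset order) (v k lam mu : ℕ) : Set where
    field
      isPDS    : IsPDS D v k lam mu
      inv-closed : ∀ d → d ∈ D → (d ⁻¹) ∈ D
      ε∉D      : ε ∉ D

  InConjClass : Fin order → Fin order → Set
  InConjClass g h = Σ (Fin order) λ x → g ≡ (x ∙ h) ∙ (x ⁻¹)

  inConjClass? : ∀ g h → Relation.Nullary.Dec (InConjClass g h)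
  inConjClass? g h = any? (λ x → g ≟ ((x ∙ h) ∙ (x ⁻¹)))

  conjClassMeetCount : Fin order → Subset order → ℕ
  conjClassMeetCount h D =
    length (filter (λ g → (g ∈? D) ×-dec inConjClass? g h) (allFin order))

{-# OPTIONS --safe #-}
-- Inversion maps h^G ∩ D to itself: D is inverse-closed, and (x h x⁻¹)⁻¹ = x h⁻¹ x⁻¹ is
-- conjugate to h because h⁻¹ is. It fixes no point, since a self-inverse conjugate of h
-- would force h = h⁻¹. A finite set carrying a fixed-point-free involution f has even
-- size: for any total order it is the disjoint union of {y : y < f y} and its image
-- under f.
module Submission where

open import Defs
open import Level using (Level; 0ℓ)
open import Data.Nat using (ℕ; _+_; _*_)
open import Data.Nat.Divisibility using (_∣_; divides)
open import Data.Nat.Properties using (*-comm; +-identityʳ)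
open import Data.Fin using (Fin)
open import Data.Fin.Subset as Subset using (Subset)
open import Data.Fin.Subset.Properties using (_∈?_)
import Data.Fin.Properties as Fin
open import Data.List using (List; _++_; map; filter; length; allFin)
open import Data.List.Properties using (length-++; length-map)
open import Data.List.Membership.Propositional using (_∈_)
open import Data.List.Membership.Propositional.Properties
  using (∈-filter⁺; ∈-filter⁻; ∈-map⁺; ∈-map⁻; ∈-++⁺ˡ; ∈-++⁺ʳ; ∈-++⁻; ∈-allFin)
open import Data.List.Membership.Propositional.Properties.WithK using (unique∧set⇒bag)
open import Data.List.Relation.Unary.Unique.Propositional using (Unique)
import Data.List.Relation.Unary.Unique.Propositional.Properties as Unique
open import Data.List.Relation.Binary.Disjoint.Propositional using (Disjoint)
open import Data.List.Relation.Binary.BagAndSetEquality using (_∼[_]_; set; bag; ∼bag⇒↭)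
open import Data.List.Relation.Binary.Permutation.Propositional.Properties using (↭-length)
open import Data.Product using (_×_; _,_; proj₁; proj₂)
open import Data.Sum using (inj₁; inj₂)
open import Function.Bundles using (mk⇔)
open import Relation.Nullary using (¬_; Dec; contradiction)
open import Relation.Nullary.Decidable using (_×-dec_)
open import Relation.Binary using (Rel; IsStrictTotalOrder; tri<; tri≈; tri>)
open import Relation.Binary.PropositionalEquality
  using (_≡_; _≢_; refl; sym; trans; cong; subst; module ≡-Reasoning)
open import Algebra.Definitions using (Involutive)
open import Algebra.Bundles using (Group)
import Algebra.Properties.Group as GroupProperties

module FixedPointFreeInvolution
  {a ℓ : Level} {A : Set a} {_<_ : Rel A ℓ}
  (<-isStrictTotalOrder : IsStrictTotalOrder _≡_ _<_)
  {f : A → A} (f-involutive : Involutive _≡_ f)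
  where

  open IsStrictTotalOrder <-isStrictTotalOrder using (compare; asym; _<?_)

  f-injective : ∀ {x y} → f x ≡ f y → x ≡ y
  f-injective {x} {y} fx≡fy =
    trans (sym (f-involutive x)) (trans (cong f fx≡fy) (f-involutive y))

  below? : ∀ y → Dec (y < f y)
  below? y = y <? f y

  lowerHalf : List A → List A
  lowerHalf = filter below?

  module _ {xs : List A}
           (closed : ∀ {y} → y ∈ xs → f y ∈ xs)
           (fixedPointFree : ∀ {y} → y ∈ xs → f y ≢ y)
           where

    ∼lowerHalf++map : xs ∼[ set ] lowerHalf xs ++ map f (lowerHalf xs)
    ∼lowerHalf++map = mk⇔ to from
      where
      to : ∀ {y} → y ∈ xs → y ∈ lowerHalf xs ++ map f (lowerHalf xs)
      to {y} y∈xs with compare y (f y)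
      ... | tri< y<fy _ _ = ∈-++⁺ˡ (∈-filter⁺ below? y∈xs y<fy)
      ... | tri≈ _ y≡fy _ = contradiction (sym y≡fy) (fixedPointFree y∈xs)
      ... | tri> _ _ fy<y = ∈-++⁺ʳ (lowerHalf xs)
        (subst (_∈ map f (lowerHalf xs)) (f-involutive y)
          (∈-map⁺ f (∈-filter⁺ below? (closed y∈xs)
            (subst (f y <_) (sym (f-involutive y)) fy<y))))

      from : ∀ {y} → y ∈ lowerHalf xs ++ map f (lowerHalf xs) → y ∈ xs
      from {y} y∈ with ∈-++⁻ (lowerHalf xs) y∈
      ... | inj₁ y∈lower = proj₁ (∈-filter⁻ below? {xs = xs} y∈lower)
      ... | inj₂ y∈upper with ∈-map⁻ f y∈upper
      ... | z , z∈lower , refl = closed (proj₁ (∈-filter⁻ below? {xs = xs} z∈lower))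

  lowerHalf-disjoint-map : ∀ xs → Disjoint (lowerHalf xs) (map f (lowerHalf xs))
  lowerHalf-disjoint-map xs (y∈lower , y∈upper) with ∈-map⁻ f y∈upper
  ... | z , z∈lower , refl =
    asym (proj₂ (∈-filter⁻ below? {xs = xs} z∈lower))
         (subst (f z <_) (f-involutive z) (proj₂ (∈-filter⁻ below? {xs = xs} y∈lower)))

  unique-lowerHalf++map : ∀ {xs} → Unique xs → Unique (lowerHalf xs ++ map f (lowerHalf xs))
  unique-lowerHalf++map {xs} xs! =
    Unique.++⁺ lower! (Unique.map⁺ f-injective lower!) (lowerHalf-disjoint-map xs)
    where lower! = Unique.filter⁺ below? xs!

  fixedPointFree⇒even-length : ∀ {xs} → Unique xs
    → (∀ {y} → y ∈ xs → f y ∈ xs) → (∀ {y} → y ∈ xs → f y ≢ y) → 2 ∣ length xs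
  fixedPointFree⇒even-length {xs} xs! closed fixedPointFree = divides (length half) (begin
    length xs                          ≡⟨ ↭-length (∼bag⇒↭ xs∼half++map) ⟩
    length (half ++ map f half)        ≡⟨ length-++ half ⟩
    length half + length (map f half)  ≡⟨ cong (length half +_) (length-map f half) ⟩
    length half + length half          ≡⟨ cong (length half +_) (+-identityʳ (length half)) ⟨
    2 * length half                    ≡⟨ *-comm 2 (length half) ⟩
    length half * 2                    ∎)
    where
    open ≡-Reasoning

    half : List A
    half = lowerHalf xs

    xs∼half++map : xs ∼[ bag ] half ++ map f half
    xs∼half++map =
      unique∧set⇒bag xs! (unique-lowerHalf++map xs!) (∼lowerHalf++map closed fixedPointFree)

module Conjugation {c ℓ : Level} (G : Group c ℓ) where

  open Group G
  open GroupProperties G using (⁻¹-anti-homo-∙; ⁻¹-involutive; ∙-cancelˡ; ∙-cancelʳ)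
  open import Relation.Binary.Reasoning.Setoid setoid

  conjugate-⁻¹ : ∀ x a → ((x ∙ a) ∙ x ⁻¹) ⁻¹ ≈ (x ∙ a ⁻¹) ∙ x ⁻¹
  conjugate-⁻¹ x a = begin
    ((x ∙ a) ∙ x ⁻¹) ⁻¹    ≈⟨ ⁻¹-anti-homo-∙ (x ∙ a) (x ⁻¹) ⟩
    x ⁻¹ ⁻¹ ∙ (x ∙ a) ⁻¹   ≈⟨ ∙-cong (⁻¹-involutive x) (⁻¹-anti-homo-∙ x a) ⟩
    x ∙ (a ⁻¹ ∙ x ⁻¹)      ≈⟨ assoc x (a ⁻¹) (x ⁻¹) ⟨
    (x ∙ a ⁻¹) ∙ x ⁻¹      ∎

  conjugate-∙ : ∀ x y a → (x ∙ ((y ∙ a) ∙ y ⁻¹)) ∙ x ⁻¹ ≈ ((x ∙ y) ∙ a) ∙ (x ∙ y) ⁻¹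
  conjugate-∙ x y a = begin
    (x ∙ ((y ∙ a) ∙ y ⁻¹)) ∙ x ⁻¹  ≈⟨ assoc x _ _ ⟩
    x ∙ (((y ∙ a) ∙ y ⁻¹) ∙ x ⁻¹)  ≈⟨ ∙-congˡ (assoc (y ∙ a) _ _) ⟩
    x ∙ ((y ∙ a) ∙ (y ⁻¹ ∙ x ⁻¹))  ≈⟨ assoc x _ _ ⟨
    (x ∙ (y ∙ a)) ∙ (y ⁻¹ ∙ x ⁻¹)  ≈⟨ ∙-cong (assoc x y a) (⁻¹-anti-homo-∙ x y) ⟨
    ((x ∙ y) ∙ a) ∙ (x ∙ y) ⁻¹     ∎

  conjugate-injective : ∀ x {a b} → (x ∙ a) ∙ x ⁻¹ ≈ (x ∙ b) ∙ x ⁻¹ → a ≈ b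
  conjugate-injective x eq = ∙-cancelˡ x _ _ (∙-cancelʳ (x ⁻¹) _ _ eq)

module _ (G : FiniteGroup) where

  open FiniteGroup G

  group : Group 0ℓ 0ℓ
  group = record { isGroup = isGroup }

  open Conjugation group
  open ≡-Reasoning

  inConjClass-⁻¹ : ∀ {g h} → InConjClass G (h ⁻¹) h →
                   InConjClass G g h → InConjClass G (g ⁻¹) h
  inConjClass-⁻¹ {g} {h} (y , h⁻¹≡yhy⁻¹) (x , g≡xhx⁻¹) = x ∙ y , (begin
    g ⁻¹                           ≡⟨ cong _⁻¹ g≡xhx⁻¹ ⟩
    ((x ∙ h) ∙ x ⁻¹) ⁻¹            ≡⟨ conjugate-⁻¹ x h ⟩
    (x ∙ h ⁻¹) ∙ x ⁻¹              ≡⟨ cong (λ z → (x ∙ z) ∙ x ⁻¹) h⁻¹≡yhy⁻¹ ⟩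
    (x ∙ ((y ∙ h) ∙ y ⁻¹)) ∙ x ⁻¹  ≡⟨ conjugate-∙ x y h ⟩
    ((x ∙ y) ∙ h) ∙ (x ∙ y) ⁻¹     ∎)

  selfInverse-conjugate⇒selfInverse : ∀ {g h} → InConjClass G g h → g ⁻¹ ≡ g → h ⁻¹ ≡ h
  selfInverse-conjugate⇒selfInverse {h = h} (x , refl) g⁻¹≡g =
    conjugate-injective x (trans (sym (conjugate-⁻¹ x h)) g⁻¹≡g)

lemma4p6 : (G : FiniteGroup) (D : Subset (FiniteGroup.order G)) (v k lam mu : ℕ)
    → IsRegularPDS G D v k lam mu
    → (h : Fin (FiniteGroup.order G))
    → ¬ (h ≡ FiniteGroup._⁻¹ G h)
    → InConjClass G (FiniteGroup._⁻¹ G h) h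
    → 2 ∣ conjClassMeetCount G h D
lemma4p6 G D v k lam mu regular h h≢h⁻¹ h⁻¹∈hᴳ =
  fixedPointFree⇒even-length (Unique.filter⁺ inD∩hᴳ? (Unique.allFin⁺ order)) closed fixedPointFree
  where
  open FiniteGroup G
  open IsRegularPDS regular using (inv-closed)
  open FixedPointFreeInvolution Fin.<-isStrictTotalOrder {f = _⁻¹}
    (GroupProperties.⁻¹-involutive (group G))

  inD∩hᴳ? : ∀ g → Dec (g Subset.∈ D × InConjClass G g h)
  inD∩hᴳ? g = (g ∈? D) ×-dec inConjClass? G g h

  D∩hᴳ : List (Fin order)
  D∩hᴳ = filter inD∩hᴳ? (allFin order)

  ∈D∩hᴳ⁻ : ∀ {g} → g ∈ D∩hᴳ → g Subset.∈ D × InConjClass G g h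
  ∈D∩hᴳ⁻ g∈ = proj₂ (∈-filter⁻ inD∩hᴳ? {xs = allFin order} g∈)

  closed : ∀ {g} → g ∈ D∩hᴳ → g ⁻¹ ∈ D∩hᴳ
  closed g∈ with g∈D , g∈hᴳ ← ∈D∩hᴳ⁻ g∈ =
    ∈-filter⁺ inD∩hᴳ? (∈-allFin _) (inv-closed _ g∈D , inConjClass-⁻¹ G h⁻¹∈hᴳ g∈hᴳ)

  fixedPointFree : ∀ {g} → g ∈ D∩hᴳ → g ⁻¹ ≢ g
  fixedPointFree g∈ g⁻¹≡g =
    h≢h⁻¹ (sym (selfInverse-conjugate⇒selfInverse G (proj₂ (∈D∩hᴳ⁻ g∈)) g⁻¹≡g))
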